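{- For all integers $n$ and $k$ with $n\geq k\geq 8$, $\mathrm{ex}_{\mathcal{P}}^{*}(n,P_k)=3n-6$.
   Context: $P_k$ denotes the path on $k$ vertices. An edge-coloring is proper if no two edges sharing a vertex receive the same color. A subgraph is rainbow if all its edges receive distinct colors. A properly edge-colored graph $G$ is rainbow-$F$-free if it contains no subgraph isomorphic to $F$ that is rainbow under the coloring of $G$. The rainbow planar Turán number $\mathrm{ex}_{\mathcal{P}}^{*}(n,F)$ is the maximum number of edges in an $n$-vertex planar graph admitting a proper edge-coloring under which it is rainbow-$F$-free. -}

module Defs where

open import Data.Nat using (ℕ; zero; suc; _+_; _*_; _∸_; _≤_; _≤ᵇ_; _<ᵇ_)
open import Data.Fin using (Fin; toℕ; inject₁) renaming (zero to fzero; suc to fsuc)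
open import Data.Bool using (Bool; true; false; _∧_; if_then_else_)
open import Data.Product using (Σ; ∃; ∃-syntax; _×_; _,_; proj₁; proj₂)
open import Data.Sum using (_⊎_)
open import Relation.Binary.PropositionalEquality using (_≡_; _≢_)
open import Relation.Nullary using (¬_)
open import Data.Unit using (⊤)

sumFin : ∀ {m} → (Fin m → ℕ) → ℕ
sumFin {zero}  f = 0
sumFin {suc m} f = f fzero + sumFin (λ i → f (fsuc i))

iter : ∀ {A : Set} → (A → A) → ℕ → A → A
iter f zero    x = x
iter f (suc t) x = f (iter f t x)

allBelow : ℕ → (ℕ → Bool) → Bool
allBelow zero    p = true
allBelow (suc N) p = allBelow N p ∧ p N

record Graph (n : ℕ) : Set where
  field
    adj    : Fin n → Fin n → Bool
    sym    : ∀ u v → adj u v ≡ adj v u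
    irrefl : ∀ u → adj u u ≡ false
open Graph public

Adj : ∀ {n} → Graph n → Fin n → Fin n → Set
Adj G u v = adj G u v ≡ true

edgeCount : ∀ {n} → Graph n → ℕ
edgeCount G = sumFin λ u → sumFin λ v →
  if (toℕ u <ᵇ toℕ v) ∧ adj G u v then 1 else 0

_⊆G_ : ∀ {n} → Graph n → Graph n → Set
G ⊆G H = ∀ u v → Adj G u v → Adj H u v

data Reach {n} (G : Graph n) : Fin n → Fin n → Set where
  here : ∀ {u} → Reach G u u
  step : ∀ {u v w} → Adj G u v → Reach G v w → Reach G u w

Connected : ∀ {n} → Graph n → Set
Connected G = ∀ u v → Reach G u v

-- rot u is a cyclic permutation of the neighbourhood N(u) of u:
-- it maps N(u) into N(u) and every neighbour reaches every other one.
IsRotationSystem : ∀ {n} → Graph n → (Fin n → Fin n → Fin n) → Set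
IsRotationSystem G rot =
  (∀ u v → Adj G u v → Adj G u (rot u v)) ×
  (∀ u v w → Adj G u v → Adj G u w → ∃[ t ] iter (rot u) t v ≡ w)

-- face-tracing permutation on darts (u , v):  (u , v) ↦ (v , rot v u)
faceStep : ∀ {n} → (Fin n → Fin n → Fin n) → Fin n × Fin n → Fin n × Fin n
faceStep rot (u , v) = v , rot v u

dartKey : ∀ {n} → Fin n × Fin n → ℕ
dartKey {n} (u , v) = toℕ u * n + toℕ v

-- a dart is the representative of its face iff it has the least key in
-- its orbit (orbits have length ≤ n * n, so n * n iterates suffice)
isFaceRep : ∀ {n} → (Fin n → Fin n → Fin n) → Fin n × Fin n → Bool
isFaceRep {n} rot d =
  allBelow (n * n) λ t → dartKey d ≤ᵇ dartKey (iter (faceStep rot) t d)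

-- number of faces of the embedding = number of face orbits on darts
faceCount : ∀ {n} → Graph n → (Fin n → Fin n → Fin n) → ℕ
faceCount G rot = sumFin λ u → sumFin λ v →
  if adj G u v ∧ isFaceRep rot (u , v) then 1 else 0

-- A connected graph is planar iff it has a rotation system of genus 0,
-- i.e. V - E + F = 2 (or it has no edges).
PlanarConnected : ∀ {n} → Graph n → Set
PlanarConnected {n} H =
  Connected H ×
  ∃[ rot ] (IsRotationSystem H rot ×
            (edgeCount H ≡ 0 ⊎ n + faceCount H rot ≡ edgeCount H + 2))

Planar : ∀ {n} → Graph n → Set
Planar {n} G = ∃[ H ] (G ⊆G H × PlanarConnected H)

ProperColouring : ∀ {n} → Graph n → (Fin n → Fin n → ℕ) → Set
ProperColouring G c =
  (∀ u v → Adj G u v → c u v ≡ c v u) ×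
  (∀ u v w → Adj G u v → Adj G u w → v ≢ w → c u v ≢ c u w)

IsPath : ∀ {n m} → Graph n → (Fin (suc m) → Fin n) → Set
IsPath {m = m} G f =
  (∀ i j → f i ≡ f j → i ≡ j) ×
  (∀ (i : Fin m) → Adj G (f (inject₁ i)) (f (fsuc i)))

IsRainbowPath : ∀ {n m} → Graph n → (Fin n → Fin n → ℕ) →
                (Fin (suc m) → Fin n) → Set
IsRainbowPath {m = m} G c f =
  IsPath G f ×
  (∀ (i j : Fin m) → i ≢ j →
     c (f (inject₁ i)) (f (fsuc i)) ≢ c (f (inject₁ j)) (f (fsuc j)))

-- rainbow-P_k-free (k ≥ 1); P_k has k vertices
RainbowPathFree : ∀ {n} → (k : ℕ) → Graph n → (Fin n → Fin n → ℕ) → Set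
RainbowPathFree zero    G c = ⊤
RainbowPathFree (suc m) G c = ¬ (∃[ f ] IsRainbowPath {m = m} G c f)

AdmitsRainbowPathFree : ∀ {n} → ℕ → Graph n → Set
AdmitsRainbowPathFree k G =
  ∃[ c ] (ProperColouring G c × RainbowPathFree k G c)

-- ex*_P(n, P_k) = N : N is the maximum number of edges of an n-vertex
-- planar graph admitting a proper rainbow-P_k-free edge-colouring
RainbowPlanarTuranPath≡ : ℕ → ℕ → ℕ → Set
RainbowPlanarTuranPath≡ n k N =
  (∃[ G ] (Planar {n} G × AdmitsRainbowPathFree k G × edgeCount G ≡ N)) ×
  (∀ (G : Graph n) → Planar G → AdmitsRainbowPathFree k G → edgeCount G ≤ N)

-- In a connected plane graph on n ≥ 3 vertices no face has length one or two, so
-- counting darts face by face gives 3F ≤ 2E, and Euler's formula n + F = E + 2 turns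
-- this into E ≤ 3n − 6; passing to a spanning subgraph only loses edges.
-- Conversely, the triangulation K₂ + P_{n−2} (two adjacent apices joined to every
-- vertex of a path) has 3n − 6 edges. Colour the path edges alternately 0 and 1 and
-- the apex edges properly with larger colours. An edge of a rainbow path either has
-- colour 0 or 1 (at most two such edges) or meets one of the two apices (at most two
-- edges each), so a rainbow path has at most 6 edges and no rainbow P₈ exists.

module Submission where

open import Defs hiding (sym)
open import Data.Bool using (Bool; true; false; _∧_; _∨_; if_then_else_; T)
open import Data.Bool.Properties using (∨-comm; ∨-zeroʳ)
open import Data.Empty using (⊥-elim)
open import Data.Fin as Fin
  using (Fin; toℕ; inject₁; fromℕ; combine; remQuot; _↑ˡ_; _↑ʳ_; punchOut)
  renaming (zero to fzero; suc to fsuc)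
open import Data.Fin.Permutation using (Permutation; permutation)
open import Data.Fin.Properties as FinP
  using (toℕ-injective; toℕ<n; any?; pigeonhole; injective⇒≤; punchOut-injective;
         combine-injective; remQuot-combine; combine-remQuot; toℕ-combine)
open import Data.Nat hiding (parity)
open import Data.Nat.Properties
open import Data.Product using (∃-syntax; _×_; _,_; proj₁; proj₂; uncurry)
open import Data.Sum using (_⊎_; inj₁; inj₂)
open import Data.Unit using (tt)
open import Relation.Binary.PropositionalEquality
open import Relation.Nullary using (¬_; yes; no)
open import Relation.Binary.Definitions using (tri<; tri≈; tri>)
import Algebra.Properties.CommutativeMonoid.Sum as CommutativeMonoidSum
open import Data.Nat.Solver using (module +-*-Solver)

module ℕ-Sum = CommutativeMonoidSum +-0-commutativeMonoid

ind : Bool → ℕ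
ind b = if b then 1 else 0

<ᵇ-true : ∀ {m n} → m < n → (m <ᵇ n) ≡ true
<ᵇ-true {m} {n} m<n with m <ᵇ n | <⇒<ᵇ m<n
... | true | _ = refl

<ᵇ-false : ∀ {m n} → n ≤ m → (m <ᵇ n) ≡ false
<ᵇ-false {m} {n} n≤m with m <ᵇ n in eq
... | false = refl
... | true  = ⊥-elim (<⇒≱ (<ᵇ⇒< m n (subst T (sym eq) tt)) n≤m)

≡ᵇ-refl : ∀ x → (x ≡ᵇ x) ≡ true
≡ᵇ-refl zero    = refl
≡ᵇ-refl (suc x) = ≡ᵇ-refl x

≡ᵇ-true⇒≡ : ∀ x y → (x ≡ᵇ y) ≡ true → x ≡ y
≡ᵇ-true⇒≡ x y eq = ≡ᵇ⇒≡ x y (subst T (sym eq) tt)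

≡ᵇ-false : ∀ {x y} → x ≢ y → (x ≡ᵇ y) ≡ false
≡ᵇ-false {x} {y} x≢y with x ≡ᵇ y in eq
... | false = refl
... | true  = ⊥-elim (x≢y (≡ᵇ-true⇒≡ x y eq))

∧-true : ∀ {a b} → a ∧ b ≡ true → a ≡ true × b ≡ true
∧-true {true} {true} _ = refl , refl

sumFin≡sum : ∀ {m} (f : Fin m → ℕ) → sumFin f ≡ ℕ-Sum.sum f
sumFin≡sum {zero}  f = refl
sumFin≡sum {suc m} f = cong (f fzero +_) (sumFin≡sum (λ i → f (fsuc i)))

sumFin-cong : ∀ {m} {f g : Fin m → ℕ} → (∀ i → f i ≡ g i) → sumFin f ≡ sumFin g
sumFin-cong {zero}  f≗g = refl
sumFin-cong {suc m} f≗g = cong₂ _+_ (f≗g fzero) (sumFin-cong (λ i → f≗g (fsuc i)))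

sumFin-mono : ∀ {m} {f g : Fin m → ℕ} → (∀ i → f i ≤ g i) → sumFin f ≤ sumFin g
sumFin-mono {zero}  f≤g = z≤n
sumFin-mono {suc m} f≤g = +-mono-≤ (f≤g fzero) (sumFin-mono (λ i → f≤g (fsuc i)))

sumFin-distrib-+ : ∀ {m} (f g : Fin m → ℕ) →
                   sumFin (λ i → f i + g i) ≡ sumFin f + sumFin g
sumFin-distrib-+ f g = begin
  sumFin (λ i → f i + g i)        ≡⟨ sumFin≡sum (λ i → f i + g i) ⟩
  ℕ-Sum.sum (λ i → f i + g i)     ≡⟨ ℕ-Sum.∑-distrib-+ f g ⟩
  ℕ-Sum.sum f + ℕ-Sum.sum g       ≡⟨ sym (cong₂ _+_ (sumFin≡sum f) (sumFin≡sum g)) ⟩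
  sumFin f + sumFin g             ∎
  where open ≡-Reasoning

sumFin-zero : ∀ {m} → sumFin {m} (λ _ → 0) ≡ 0
sumFin-zero {zero}  = refl
sumFin-zero {suc m} = sumFin-zero {m}

sumFin-one : ∀ m → sumFin {m} (λ _ → 1) ≡ m
sumFin-one zero    = refl
sumFin-one (suc m) = cong suc (sumFin-one m)

sumFin-comm : ∀ {m n} (f : Fin m → Fin n → ℕ) →
              sumFin (λ i → sumFin (f i)) ≡ sumFin (λ j → sumFin (λ i → f i j))
sumFin-comm {zero}  {n} f = sym (sumFin-zero {n})
sumFin-comm {suc m} {n} f =
  trans (cong (sumFin (f fzero) +_) (sumFin-comm (λ i → f (fsuc i))))
        (sym (sumFin-distrib-+ (f fzero) (λ j → sumFin (λ i → f (fsuc i) j))))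

sumFin-init≤ : ∀ {m} (f : Fin (suc m) → ℕ) → sumFin (λ i → f (inject₁ i)) ≤ sumFin f
sumFin-init≤ {m} f = begin
  sumFin (λ i → f (inject₁ i))       ≤⟨ m≤m+n _ (f (fromℕ m)) ⟩
  sumFin (λ i → f (inject₁ i)) + f (fromℕ m)
    ≡⟨ cong (_+ f (fromℕ m)) (sumFin≡sum (λ i → f (inject₁ i))) ⟩
  ℕ-Sum.sum (λ i → f (inject₁ i)) + f (fromℕ m)
    ≡⟨ sym (ℕ-Sum.sum-init-last f) ⟩
  ℕ-Sum.sum f                        ≡⟨ sym (sumFin≡sum f) ⟩
  sumFin f                           ∎
  where open ≤-Reasoning

sumFin-tail≤ : ∀ {m} (f : Fin (suc m) → ℕ) → sumFin (λ i → f (fsuc i)) ≤ sumFin f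
sumFin-tail≤ f = m≤n+m _ (f fzero)

sumFin-↑ : ∀ a b (f : Fin (a + b) → ℕ) →
           sumFin f ≡ sumFin (λ i → f (i ↑ˡ b)) + sumFin (λ j → f (a ↑ʳ j))
sumFin-↑ zero    b f = refl
sumFin-↑ (suc a) b f = trans (cong (f fzero +_) (sumFin-↑ a b (λ i → f (fsuc i))))
                             (sym (+-assoc (f fzero) _ _))

sumFin-combine : ∀ m n (f : Fin (m * n) → ℕ) →
                 sumFin f ≡ sumFin (λ i → sumFin (λ j → f (combine {m} {n} i j)))
sumFin-combine zero    n f = refl
sumFin-combine (suc m) n f =
  trans (sumFin-↑ n (m * n) f)
        (cong (sumFin (λ j → f (j ↑ˡ (m * n))) +_) (sumFin-combine m n (λ k → f (n ↑ʳ k))))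

injective⇒surjective : ∀ {n} (π : Fin n → Fin n) → (∀ {x y} → π x ≡ π y → x ≡ y) →
                       ∀ y → ∃[ x ] π x ≡ y
injective⇒surjective {zero}  π inj ()
injective⇒surjective {suc n} π inj y with any? (λ x → π x Fin.≟ y)
... | yes hit = hit
... | no miss = ⊥-elim (1+n≰n (injective⇒≤ {f = π′} π′-injective))
  where
  y≢π : ∀ x → y ≢ π x
  y≢π x y≡πx = miss (x , sym y≡πx)
  π′ : Fin (suc n) → Fin n
  π′ x = punchOut (y≢π x)
  π′-injective : ∀ {x x′} → π′ x ≡ π′ x′ → x ≡ x′
  π′-injective {x} {x′} eq = inj (punchOut-injective (y≢π x) (y≢π x′) eq)

sumFin-reindex : ∀ {n} (f : Fin n → ℕ) (π : Fin n → Fin n) →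
                   (∀ {x y} → π x ≡ π y → x ≡ y) → sumFin (λ i → f (π i)) ≡ sumFin f
sumFin-reindex f π inj = begin
  sumFin (λ i → f (π i))          ≡⟨ sumFin≡sum (λ i → f (π i)) ⟩
  ℕ-Sum.sum (λ i → f (π i))       ≡⟨ sym (ℕ-Sum.∑-permute f P) ⟩
  ℕ-Sum.sum f                     ≡⟨ sym (sumFin≡sum f) ⟩
  sumFin f                        ∎
  where
  open ≡-Reasoning
  P : Permutation _ _
  P = permutation π (λ y → proj₁ (injective⇒surjective π inj y))
        (λ y → proj₂ (injective⇒surjective π inj y))
        (λ x → inj (proj₂ (injective⇒surjective π inj (π x))))

count-≡-injective : ∀ {m} (c : Fin m → ℕ) → (∀ {i j} → c i ≡ c j → i ≡ j) →
                    ∀ v → sumFin (λ i → ind (c i ≡ᵇ v)) ≤ 1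
count-≡-injective {zero}  c inj v = z≤n
count-≡-injective {suc m} c inj v with c fzero ≟ v
... | no  c₀≢v rewrite ≡ᵇ-false c₀≢v =
  count-≡-injective (λ i → c (fsuc i)) (λ eq → FinP.suc-injective (inj eq)) v
... | yes refl rewrite ≡ᵇ-refl (c fzero) = s≤s (≤-reflexive (trans (sumFin-cong none) (sumFin-zero {m})))
  where
  none : ∀ i → ind (c (fsuc i) ≡ᵇ c fzero) ≡ 0
  none i rewrite ≡ᵇ-false {c (fsuc i)} {c fzero} (λ eq → FinP.0≢1+n (sym (inj eq))) = refl

count-<-injective : ∀ {m} (c : Fin m → ℕ) → (∀ {i j} → c i ≡ c j → i ≡ j) →
                    ∀ K → sumFin (λ i → ind (c i <ᵇ K)) ≤ K
count-<-injective {m} c inj zero = ≤-reflexive (sumFin-zero {m})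
count-<-injective c inj (suc K) = begin
  sumFin (λ i → ind (c i <ᵇ suc K))                          ≤⟨ sumFin-mono (λ i → split (c i)) ⟩
  sumFin (λ i → ind (c i <ᵇ K) + ind (c i ≡ᵇ K))
    ≡⟨ sumFin-distrib-+ (λ i → ind (c i <ᵇ K)) (λ i → ind (c i ≡ᵇ K)) ⟩
  sumFin (λ i → ind (c i <ᵇ K)) + sumFin (λ i → ind (c i ≡ᵇ K))
    ≤⟨ +-mono-≤ (count-<-injective c inj K) (count-≡-injective c inj K) ⟩
  K + 1                                                      ≡⟨ +-comm K 1 ⟩
  suc K                                                      ∎
  where
  open ≤-Reasoning
  split : ∀ x → ind (x <ᵇ suc K) ≤ ind (x <ᵇ K) + ind (x ≡ᵇ K)
  split x with <-cmp x K
  ... | tri< x<K _ _ rewrite <ᵇ-true x<K | <ᵇ-true (m<n⇒m<1+n x<K) = s≤s z≤n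
  ... | tri≈ _ refl _ rewrite ≡ᵇ-refl x | <ᵇ-false (≤-refl {x}) | <ᵇ-true (n<1+n x) = s≤s z≤n
  ... | tri> _ _ K<x rewrite <ᵇ-false K<x = z≤n

Σ< : ℕ → (ℕ → ℕ) → ℕ
Σ< k g = sumFin {k} (λ i → g (toℕ i))

Σ<-≡ᵇ : ∀ k c → Σ< k (λ j → ind (j ≡ᵇ c)) ≡ ind (c <ᵇ k)
Σ<-≡ᵇ zero    c       = refl
Σ<-≡ᵇ (suc k) zero    = cong suc (sumFin-zero {k})
Σ<-≡ᵇ (suc k) (suc c) = Σ<-≡ᵇ k c

Σ<-<ᵇ : ∀ k M → Σ< k (λ i → ind (i <ᵇ M)) ≡ k ⊓ M
Σ<-<ᵇ zero    M       = refl
Σ<-<ᵇ (suc k) zero    = sumFin-zero {k}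
Σ<-<ᵇ (suc k) (suc M) = cong suc (Σ<-<ᵇ k M)

Σ² : ∀ {n} → (Fin n × Fin n → ℕ) → ℕ
Σ² h = sumFin λ u → sumFin λ v → h (u , v)

Σ²-cong : ∀ {n} {f g : Fin n × Fin n → ℕ} → (∀ d → f d ≡ g d) → Σ² f ≡ Σ² g
Σ²-cong f≗g = sumFin-cong (λ u → sumFin-cong (λ v → f≗g (u , v)))

Σ²-mono : ∀ {n} {f g : Fin n × Fin n → ℕ} → (∀ d → f d ≤ g d) → Σ² f ≤ Σ² g
Σ²-mono f≤g = sumFin-mono (λ u → sumFin-mono (λ v → f≤g (u , v)))

Σ²-distrib-+ : ∀ {n} (f g : Fin n × Fin n → ℕ) → Σ² (λ d → f d + g d) ≡ Σ² f + Σ² g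
Σ²-distrib-+ f g =
  trans (sumFin-cong (λ u → sumFin-distrib-+ (λ v → f (u , v)) (λ v → g (u , v))))
        (sumFin-distrib-+ (λ u → sumFin (λ v → f (u , v))) (λ u → sumFin (λ v → g (u , v))))

Σ²-remQuot : ∀ {n} (h : Fin n × Fin n → ℕ) → sumFin (λ i → h (remQuot n i)) ≡ Σ² h
Σ²-remQuot {n} h = trans (sumFin-combine n n (λ i → h (remQuot n i)))
  (sumFin-cong (λ u → sumFin-cong (λ v → cong h (remQuot-combine u v))))

uncurry-combine-injective : ∀ {n} {d d′ : Fin n × Fin n} →
                            uncurry combine d ≡ uncurry combine d′ → d ≡ d′
uncurry-combine-injective {d = u , v} {u′ , v′} eq with combine-injective u v u′ v′ eq
... | refl , refl = refl

Σ²-reindex : ∀ {n} (h : Fin n × Fin n → ℕ) (π : Fin n × Fin n → Fin n × Fin n) →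
             (∀ {d d′} → π d ≡ π d′ → d ≡ d′) → Σ² (λ d → h (π d)) ≡ Σ² h
Σ²-reindex {n} h π π-injective = begin
  Σ² (λ d → h (π d))                  ≡⟨ sym (Σ²-remQuot (λ d → h (π d))) ⟩
  sumFin (λ i → h (π (remQuot n i)))  ≡⟨ sumFin-cong (λ i → cong h (sym (remQuot-combine′ (π (remQuot n i))))) ⟩
  sumFin (λ i → h (remQuot n (π̂ i)))  ≡⟨ sumFin-reindex (λ i → h (remQuot n i)) π̂ π̂-injective ⟩
  sumFin (λ i → h (remQuot n i))      ≡⟨ Σ²-remQuot h ⟩
  Σ² h                                ∎
  where
  open ≡-Reasoning
  encode : Fin n × Fin n → Fin (n * n)
  encode = uncurry combine
  remQuot-combine′ : ∀ d → remQuot n (encode d) ≡ d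
  remQuot-combine′ (u , v) = remQuot-combine u v
  π̂ : Fin (n * n) → Fin (n * n)
  π̂ i = encode (π (remQuot n i))
  remQuot-injective : ∀ {i j} → remQuot {n} n i ≡ remQuot n j → i ≡ j
  remQuot-injective {i} {j} eq = begin
    i                                ≡⟨ sym (combine-remQuot {n} n i) ⟩
    encode (remQuot n i)             ≡⟨ cong encode eq ⟩
    encode (remQuot n j)             ≡⟨ combine-remQuot {n} n j ⟩
    j                                ∎
  π̂-injective : ∀ {i j} → π̂ i ≡ π̂ j → i ≡ j
  π̂-injective eq = remQuot-injective (π-injective (uncurry-combine-injective eq))

-- Faces of a rotation system

iter-+ : ∀ {A : Set} (f : A → A) a b x → iter f (a + b) x ≡ iter f a (iter f b x)
iter-+ f zero    b x = refl
iter-+ f (suc a) b x = cong f (iter-+ f a b x)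

iter-suc : ∀ {A : Set} (f : A → A) a x → iter f (suc a) x ≡ iter f a (f x)
iter-suc f a x = trans (cong (λ k → iter f k x) (+-comm 1 a)) (iter-+ f a 1 x)

iter-∸ : ∀ {A : Set} (f : A → A) {s q} x → s ≤ q → iter f q x ≡ x →
         iter f (q ∸ s) (iter f s x) ≡ x
iter-∸ f {s} {q} x s≤q fq = begin
  iter f (q ∸ s) (iter f s x)   ≡⟨ sym (iter-+ f (q ∸ s) s x) ⟩
  iter f (q ∸ s + s) x          ≡⟨ cong (λ k → iter f k x) (m∸n+n≡m s≤q) ⟩
  iter f q x                    ≡⟨ fq ⟩
  x                             ∎
  where open ≡-Reasoning

allBelow-sound : ∀ N p → allBelow N p ≡ true → ∀ t → t < N → p t ≡ true
allBelow-sound (suc N) p all t t<1+N with ∧-true {allBelow N p} all | m<1+n⇒m<n∨m≡n t<1+N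
... | below , _   | inj₁ t<N  = allBelow-sound N p below t t<N
... | _     , top | inj₂ refl = top

allBelow-complete : ∀ N p → (∀ t → t < N → p t ≡ true) → allBelow N p ≡ true
allBelow-complete zero    p all = refl
allBelow-complete (suc N) p all
  rewrite allBelow-complete N p (λ t t<N → all t (m≤n⇒m≤1+n t<N)) | all N ≤-refl = refl

isDart : ∀ {n} → Graph n → Fin n × Fin n → Bool
isDart G (u , v) = adj G u v

handshake : ∀ {n} (G : Graph n) → edgeCount G + edgeCount G ≡ Σ² (λ d → ind (isDart G d))
handshake G = begin
  edgeCount G + edgeCount G                                   ≡⟨ cong (edgeCount G +_) reversed ⟩
  Σ² (λ d → ind (forward d)) + Σ² (λ d → ind (backward d))
    ≡⟨ sym (Σ²-distrib-+ (λ d → ind (forward d)) (λ d → ind (backward d))) ⟩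
  Σ² (λ d → ind (forward d) + ind (backward d))               ≡⟨ Σ²-cong split ⟩
  Σ² (λ d → ind (isDart G d))                                 ∎
  where
  open ≡-Reasoning
  forward backward : _ → Bool
  forward  (u , v) = (toℕ u <ᵇ toℕ v) ∧ adj G u v
  backward (u , v) = (toℕ v <ᵇ toℕ u) ∧ adj G u v
  reversed : edgeCount G ≡ Σ² (λ d → ind (backward d))
  reversed = trans
    (sumFin-cong (λ u → sumFin-cong (λ v → cong (λ b → ind ((toℕ u <ᵇ toℕ v) ∧ b)) (Graph.sym G u v))))
    (sumFin-comm (λ u v → ind ((toℕ u <ᵇ toℕ v) ∧ adj G v u)))
  split : ∀ d → ind (forward d) + ind (backward d) ≡ ind (isDart G d)
  split (u , v) with <-cmp (toℕ u) (toℕ v)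
  ... | tri< u<v _ _ rewrite <ᵇ-true u<v | <ᵇ-false (<⇒≤ u<v) = +-identityʳ _
  ... | tri> _ _ v<u rewrite <ᵇ-true v<u | <ᵇ-false (<⇒≤ v<u) = refl
  ... | tri≈ _ u≡v _ rewrite toℕ-injective u≡v | Graph.irrefl G v | <ᵇ-false (≤-refl {toℕ v}) = refl

no-two-cover : ∀ {m} → 3 ≤ m → (u v : Fin m) → ¬ (∀ w → w ≡ u ⊎ w ≡ v)
no-two-cover (s≤s (s≤s (s≤s z≤n))) u v cover
  with cover fzero | cover (fsuc fzero) | cover (fsuc (fsuc fzero))
... | inj₁ refl | inj₁ ()   | _
... | inj₁ refl | inj₂ refl | inj₁ ()
... | inj₁ refl | inj₂ refl | inj₂ ()
... | inj₂ refl | inj₁ refl | inj₁ ()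
... | inj₂ refl | inj₁ refl | inj₂ ()
... | inj₂ refl | inj₂ ()   | _

module Faces {n} (G : Graph n) (rot : Fin n → Fin n → Fin n)
             (rotation : IsRotationSystem G rot) where

  Dart : Set
  Dart = Fin n × Fin n

  D : Dart → Bool
  D = isDart G

  φ : Dart → Dart
  φ = faceStep rot

  R : Dart → Bool
  R = isFaceRep rot

  key : Dart → ℕ
  key = dartKey

  rot-injective : ∀ {u x y} → Adj G u x → Adj G u y → rot u x ≡ rot u y → x ≡ y
  rot-injective {u} {x} {y} ux uy fx≡fy
    with proj₂ rotation u (rot u x) x (proj₁ rotation u x ux) ux
       | proj₂ rotation u (rot u y) y (proj₁ rotation u y uy) uy
  ... | a , fᵃ⁺¹x≡x | b , fᵇ⁺¹y≡y = begin
    x                                    ≡⟨ sym fᵃ⁺¹x≡x ⟩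
    iter f a (f x)                       ≡⟨ cong (iter f a) fx≡fy ⟩
    iter f a (f y)                       ≡⟨ sym (iter-suc f a y) ⟩
    iter f (suc a) y                     ≡⟨ cong (iter f (suc a)) y≡fᵇ⁺¹x ⟩
    iter f (suc a) (iter f (suc b) x)    ≡⟨ sym (iter-+ f (suc a) (suc b) x) ⟩
    iter f (suc a + suc b) x             ≡⟨ cong (λ k → iter f k x) (+-comm (suc a) (suc b)) ⟩
    iter f (suc b + suc a) x             ≡⟨ iter-+ f (suc b) (suc a) x ⟩
    iter f (suc b) (iter f (suc a) x)    ≡⟨ cong (iter f (suc b)) (trans (iter-suc f a x) fᵃ⁺¹x≡x) ⟩
    iter f (suc b) x                     ≡⟨ sym y≡fᵇ⁺¹x ⟩
    y                                    ∎
    where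
    open ≡-Reasoning
    f = rot u
    y≡fᵇ⁺¹x : y ≡ iter f (suc b) x
    y≡fᵇ⁺¹x = trans (sym fᵇ⁺¹y≡y) (trans (cong (iter f b) (sym fx≡fy)) (sym (iter-suc f b x)))

  reverse : ∀ {u v} → Adj G u v → Adj G v u
  reverse {u} {v} uv = trans (sym (Graph.sym G u v)) uv

  φ-dart : ∀ d → D d ≡ true → D (φ d) ≡ true
  φ-dart (u , v) uv = proj₁ rotation v u (reverse uv)

  iter-φ-dart : ∀ t d → D d ≡ true → D (iter φ t d) ≡ true
  iter-φ-dart zero    d dd = dd
  iter-φ-dart (suc t) d dd = φ-dart _ (iter-φ-dart t d dd)

  φ-injective : ∀ {d d′} → D d ≡ true → D d′ ≡ true → φ d ≡ φ d′ → d ≡ d′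
  φ-injective {u , v} {u′ , v′} uv u′v′ eq with cong proj₁ eq
  ... | refl = cong (_, v) (rot-injective (reverse uv) (reverse u′v′) (cong proj₂ eq))

  φ-irreflexive : ∀ d → D d ≡ true → φ d ≢ d
  φ-irreflexive (u , v) uv eq with cong proj₁ eq
  ... | refl with trans (sym uv) (Graph.irrefl G v)
  ... | ()

  -- a permutation of all of Fin n × Fin n, to reindex sums over darts
  φ̃ : Dart → Dart
  φ̃ d = if D d then φ d else d

  φ̃-injective : ∀ {d d′} → φ̃ d ≡ φ̃ d′ → d ≡ d′
  φ̃-injective {d} {d′} eq with D d in dd | D d′ in dd′
  ... | true  | true  = φ-injective dd dd′ eq
  ... | false | false = eq
  ... | true  | false with trans (sym dd′) (trans (cong D (sym eq)) (φ-dart d dd))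
  ... | ()
  φ̃-injective {d} {d′} eq | false | true with trans (sym dd) (trans (cong D eq) (φ-dart d′ dd′))
  ... | ()

  Σ-rotate : ∀ (P : Dart → Bool) → Σ² (λ d → ind (D d ∧ P (φ d))) ≡ Σ² (λ d → ind (D d ∧ P d))
  Σ-rotate P = trans (Σ²-cong via-φ̃) (Σ²-reindex (λ d → ind (D d ∧ P d)) φ̃ φ̃-injective)
    where
    via-φ̃ : ∀ d → ind (D d ∧ P (φ d)) ≡ ind (D (φ̃ d) ∧ P (φ̃ d))
    via-φ̃ d with D d in dd
    ... | true  rewrite φ-dart d dd = refl
    ... | false rewrite dd = refl

  key-injective : ∀ {d d′} → key d ≡ key d′ → d ≡ d′
  key-injective {u , v} {u′ , v′} eq = uncurry-combine-injective (toℕ-injective (begin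
    toℕ (combine u v)       ≡⟨ toℕ-combine u v ⟩
    n * toℕ u + toℕ v       ≡⟨ cong (_+ toℕ v) (*-comm n (toℕ u)) ⟩
    toℕ u * n + toℕ v       ≡⟨ eq ⟩
    toℕ u′ * n + toℕ v′     ≡⟨ cong (_+ toℕ v′) (*-comm (toℕ u′) n) ⟩
    n * toℕ u′ + toℕ v′     ≡⟨ sym (toℕ-combine u′ v′) ⟩
    toℕ (combine u′ v′)     ∎))
    where open ≡-Reasoning

  R-sound : ∀ {d} t → R d ≡ true → t < n * n → key d ≤ key (iter φ t d)
  R-sound {d} t rd t<n² = ≤ᵇ⇒≤ _ _ (subst T (sym (allBelow-sound (n * n) _ rd t t<n²)) tt)

  R-complete : ∀ {d} → (∀ t → key d ≤ key (iter φ t d)) → R d ≡ true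
  R-complete {d} least = allBelow-complete (n * n) _ (λ t _ → T⇒≡ (≤⇒≤ᵇ (least t)))
    where
    T⇒≡ : ∀ {b} → T b → b ≡ true
    T⇒≡ {true} _ = refl

  cancel : ∀ d i q → D d ≡ true → iter φ i d ≡ iter φ (i + q) d → iter φ q d ≡ d
  cancel d zero    q dd eq = sym eq
  cancel d (suc i) q dd eq =
    cancel d i q dd (φ-injective (iter-φ-dart i d dd) (iter-φ-dart (i + q) d dd) eq)

  -- pigeonhole on the first n * n + 1 iterates
  period : ∀ d → D d ≡ true → ∃[ q ] (0 < q × q ≤ n * n × iter φ q d ≡ d)
  period d dd with pigeonhole (n<1+n (n * n)) (λ t → uncurry combine (iter φ (toℕ t) d))
  ... | i , j , i<j , same with m≤n⇒∃[o]m+o≡n i<j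
  ... | k , i+1+k≡j = suc k , z<s , q≤n² , cancel d (toℕ i) (suc k) dd (begin
    iter φ (toℕ i) d           ≡⟨ uncurry-combine-injective same ⟩
    iter φ (toℕ j) d           ≡⟨ cong (λ m → iter φ m d) j≡i+q ⟩
    iter φ (toℕ i + suc k) d   ∎)
    where
    open ≡-Reasoning
    j≡i+q : toℕ j ≡ toℕ i + suc k
    j≡i+q = trans (sym i+1+k≡j) (sym (+-suc (toℕ i) k))
    q≤n² : suc k ≤ n * n
    q≤n² = ≤-trans (m≤n+m (suc k) (toℕ i)) (≤-trans (≤-reflexive (sym j≡i+q)) (s≤s⁻¹ (toℕ<n j)))

  R-unique : ∀ {d q s} → R d ≡ true → q ≤ n * n → iter φ q d ≡ d →
             0 < s → s ≤ q → iter φ s d ≢ d → R (iter φ s d) ≡ false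
  R-unique {d} {q} {s} rd q≤n² φᵠd≡d 0<s s≤q φˢd≢d with R (iter φ s d) in ry
  ... | false = refl
  ... | true  = ⊥-elim (φˢd≢d (sym (key-injective (≤-antisym d≤y y≤d))))
    where
    s<q : s < q
    s<q = ≤∧≢⇒< s≤q (λ s≡q → φˢd≢d (trans (cong (λ k → iter φ k d) s≡q) φᵠd≡d))
    d≤y : key d ≤ key (iter φ s d)
    d≤y = R-sound s rd (<-≤-trans s<q q≤n²)
    y≤d : key (iter φ s d) ≤ key d
    y≤d = subst (λ z → key (iter φ s d) ≤ key z) (iter-∸ φ d s≤q φᵠd≡d)
            (R-sound (q ∸ s) ry (<-≤-trans (∸-monoʳ-< 0<s s≤q) (≤-trans (m∸n≤m q 0) q≤n²)))

  R-next : ∀ d → D d ≡ true → R d ≡ true → R (φ d) ≡ false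
  R-next d dd rd with period d dd
  ... | q , 0<q , q≤n² , φᵠd≡d = R-unique rd q≤n² φᵠd≡d z<s 0<q (φ-irreflexive d dd)

  R-next² : ∀ d → D d ≡ true → φ (φ d) ≢ d → R d ≡ true → R (φ (φ d)) ≡ false
  R-next² d dd φ²d≢d rd with period d dd
  ... | suc zero    , _ , _    , φd≡d   = ⊥-elim (φ-irreflexive d dd φd≡d)
  ... | suc (suc q) , _ , q≤n² , φᵠd≡d = R-unique rd q≤n² φᵠd≡d z<s (s≤s (s≤s z≤n)) φ²d≢d

  reps-at : Dart → ℕ
  reps-at d = ind (D d ∧ R d) + ind (D d ∧ R (φ d)) + ind (D d ∧ R (φ (φ d)))

  Σ-reps-at : Σ² reps-at ≡ faceCount G rot + faceCount G rot + faceCount G rot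
  Σ-reps-at = begin
    Σ² reps-at
      ≡⟨ Σ²-distrib-+ (λ d → ind (D d ∧ R d) + ind (D d ∧ R (φ d))) (λ d → ind (D d ∧ R (φ (φ d)))) ⟩
    Σ² (λ d → ind (D d ∧ R d) + ind (D d ∧ R (φ d))) + Σ² (λ d → ind (D d ∧ R (φ (φ d))))
      ≡⟨ cong₂ _+_ (Σ²-distrib-+ (λ d → ind (D d ∧ R d)) (λ d → ind (D d ∧ R (φ d))))
                   (trans (Σ-rotate (λ d → R (φ d))) (Σ-rotate R)) ⟩
    F + Σ² (λ d → ind (D d ∧ R (φ d))) + F
      ≡⟨ cong (λ x → F + x + F) (Σ-rotate R) ⟩
    F + F + F ∎
    where
    open ≡-Reasoning
    F = faceCount G rot

  reps-at≤1 : (∀ d → D d ≡ true → φ (φ d) ≢ d) → ∀ d → reps-at d ≤ ind (D d)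
  reps-at≤1 no-digon d with D d in dd
  ... | false = ≤-refl
  ... | true with R d in rd
  ... | true rewrite R-next d dd rd | R-next² d dd (no-digon d dd) rd = ≤-refl
  ... | false with R (φ d) in rφd
  ... | true rewrite R-next (φ d) (φ-dart d dd) rφd = ≤-refl
  ... | false with R (φ (φ d))
  ... | true  = ≤-refl
  ... | false = z≤n

  module Triangle {d} (φ³d≡d : φ (φ (φ d)) ≡ d) where

    OnFace : Dart → Set
    OnFace z = z ≡ d ⊎ z ≡ φ d ⊎ z ≡ φ (φ d)

    iter-OnFace : ∀ t → OnFace (iter φ t d)
    iter-OnFace zero                = inj₁ refl
    iter-OnFace (suc zero)          = inj₂ (inj₁ refl)
    iter-OnFace (suc (suc zero))    = inj₂ (inj₂ refl)
    iter-OnFace (suc (suc (suc t))) = subst OnFace (sym φ³⁺ᵗd≡φᵗd) (iter-OnFace t)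
      where
      φ³⁺ᵗd≡φᵗd : iter φ (3 + t) d ≡ iter φ t d
      φ³⁺ᵗd≡φᵗd = trans (cong (λ k → iter φ k d) (+-comm 3 t))
                        (trans (iter-+ φ t 3 d) (cong (iter φ t) φ³d≡d))

    R-least : ∀ j → (∀ z → OnFace z → key (iter φ j d) ≤ key z) → R (iter φ j d) ≡ true
    R-least j least = R-complete (λ t → least _ (subst OnFace (iter-+ φ t j d) (iter-OnFace (t + j))))

    below-face : ∀ m → key m ≤ key d → key m ≤ key (φ d) →
                 key m ≤ key (φ (φ d)) → ∀ z → OnFace z → key m ≤ key z
    below-face _ m≤d _ _ _ (inj₁ refl)        = m≤d
    below-face _ _ m≤φd _ _ (inj₂ (inj₁ refl)) = m≤φd
    below-face _ _ _ m≤φ²d _ (inj₂ (inj₂ refl)) = m≤φ²d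

    some-R : R d ≡ true ⊎ R (φ d) ≡ true ⊎ R (φ (φ d)) ≡ true
    some-R with ≤-total (key d) (key (φ d))
    some-R | inj₁ d≤φd with ≤-total (key d) (key (φ (φ d)))
    ... | inj₁ d≤φ²d = inj₁ (R-least 0 (below-face d ≤-refl d≤φd d≤φ²d))
    ... | inj₂ φ²d≤d = inj₂ (inj₂ (R-least 2 (below-face (φ (φ d)) φ²d≤d (≤-trans φ²d≤d d≤φd) ≤-refl)))
    some-R | inj₂ φd≤d with ≤-total (key (φ d)) (key (φ (φ d)))
    ... | inj₁ φd≤φ²d = inj₂ (inj₁ (R-least 1 (below-face (φ d) φd≤d ≤-refl φd≤φ²d)))
    ... | inj₂ φ²d≤φd = inj₂ (inj₂ (R-least 2 (below-face (φ (φ d)) (≤-trans φ²d≤φd φd≤d) φ²d≤φd ≤-refl)))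

  reps-at-triangle : (∀ d → D d ≡ true → φ (φ (φ d)) ≡ d) → ∀ d → reps-at d ≡ ind (D d)
  reps-at-triangle triangle d = ≤-antisym (reps-at≤1 no-digon d) (at-least-one d)
    where
    no-digon : ∀ d → D d ≡ true → φ (φ d) ≢ d
    no-digon d dd φ²d≡d = φ-irreflexive d dd (trans (cong φ (sym φ²d≡d)) (triangle d dd))
    at-least-one : ∀ d → ind (D d) ≤ reps-at d
    at-least-one d with D d in dd
    ... | false = z≤n
    ... | true with Triangle.some-R (triangle d dd)
    ... | inj₁ rd rewrite rd = s≤s z≤n
    ... | inj₂ (inj₁ rφd) rewrite rφd = ≤-trans (m≤n+m 1 (ind (R d))) (m≤m+n _ _)
    ... | inj₂ (inj₂ rφ²d) rewrite rφ²d = m≤n+m 1 _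

  faceCount-bound : (∀ d → D d ≡ true → φ (φ d) ≢ d) →
                    faceCount G rot + faceCount G rot + faceCount G rot ≤ edgeCount G + edgeCount G
  faceCount-bound no-digon = begin
    faceCount G rot + faceCount G rot + faceCount G rot   ≡⟨ sym Σ-reps-at ⟩
    Σ² reps-at                                            ≤⟨ Σ²-mono (reps-at≤1 no-digon) ⟩
    Σ² (λ d → ind (D d))                                  ≡⟨ sym (handshake G) ⟩
    edgeCount G + edgeCount G                             ∎
    where open ≤-Reasoning

  faceCount-triangulation : (∀ d → D d ≡ true → φ (φ (φ d)) ≡ d) →
                    faceCount G rot + faceCount G rot + faceCount G rot ≡ edgeCount G + edgeCount G
  faceCount-triangulation triangle = begin
    faceCount G rot + faceCount G rot + faceCount G rot   ≡⟨ sym Σ-reps-at ⟩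
    Σ² reps-at                                            ≡⟨ Σ²-cong (reps-at-triangle triangle) ⟩
    Σ² (λ d → ind (D d))                                  ≡⟨ sym (handshake G) ⟩
    edgeCount G + edgeCount G                             ∎
    where open ≡-Reasoning

  fixed-rot⇒sole-neighbour : ∀ {v u w} → Adj G v u → rot v u ≡ u → Adj G v w → w ≡ u
  fixed-rot⇒sole-neighbour {v} {u} {w} vu fixed vw with proj₂ rotation v u w vu vw
  ... | t , rotᵗu≡w = trans (sym rotᵗu≡w) (iter-fixed t)
    where
    iter-fixed : ∀ t → iter (rot v) t u ≡ u
    iter-fixed zero    = refl
    iter-fixed (suc t) = trans (cong (rot v) (iter-fixed t)) fixed

  -- a face of length two bounds an edge whose ends have no other neighbours
  connected⇒no-digon : Connected G → 3 ≤ n → ∀ d → D d ≡ true → φ (φ d) ≢ d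
  connected⇒no-digon connected 3≤n (u , v) uv φ²d≡d =
    no-two-cover 3≤n u v (λ w → stays-in-edge (inj₁ refl) (connected u w))
    where
    u-sole : ∀ {w} → Adj G u w → w ≡ v
    u-sole = fixed-rot⇒sole-neighbour uv (trans (cong (λ z → rot z v) (sym (cong proj₁ φ²d≡d)))
                                              (cong proj₂ φ²d≡d))
    v-sole : ∀ {w} → Adj G v w → w ≡ u
    v-sole = fixed-rot⇒sole-neighbour (reverse uv) (cong proj₁ φ²d≡d)
    stays-in-edge : ∀ {x w} → x ≡ u ⊎ x ≡ v → Reach G x w → w ≡ u ⊎ w ≡ v
    stays-in-edge x∈uv             here          = x∈uv
    stays-in-edge (inj₁ refl) (step xy y⇝w) = stays-in-edge (inj₂ (u-sole xy)) y⇝w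
    stays-in-edge (inj₂ refl) (step xy y⇝w) = stays-in-edge (inj₁ (v-sole xy)) y⇝w

-- The upper bound

edgeCount-mono : ∀ {n} {G H : Graph n} → G ⊆G H → edgeCount G ≤ edgeCount H
edgeCount-mono {G = G} {H} G⊆H = sumFin-mono (λ u → sumFin-mono (λ v → edge≤ u v))
  where
  edge≤ : ∀ u v → ind ((toℕ u <ᵇ toℕ v) ∧ adj G u v) ≤ ind ((toℕ u <ᵇ toℕ v) ∧ adj H u v)
  edge≤ u v with toℕ u <ᵇ toℕ v
  ... | false = ≤-refl
  ... | true with adj G u v in uv
  ... | false = z≤n
  ... | true rewrite G⊆H u v uv = ≤-refl

euler-bound : ∀ n E F → n + F ≡ E + 2 → F + F + F ≤ E + E → E ≤ 3 * n ∸ 6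
euler-bound n E F euler 3F≤2E = m+n≤o⇒m≤o∸n E (+-cancelʳ-≤ (F + F + F) (E + 6) (3 * n) (begin
  E + 6 + (F + F + F)   ≤⟨ +-monoʳ-≤ (E + 6) 3F≤2E ⟩
  E + 6 + (E + E)       ≡⟨ solve 1 (λ e → e :+ con 6 :+ (e :+ e) := (e :+ con 2) :* con 3) refl E ⟩
  (E + 2) * 3           ≡⟨ cong (_* 3) (sym euler) ⟩
  (n + F) * 3           ≡⟨ solve 2 (λ a b → (a :+ b) :* con 3 := con 3 :* a :+ (b :+ b :+ b)) refl n F ⟩
  3 * n + (F + F + F)   ∎))
  where
  open +-*-Solver
  open ≤-Reasoning

planar⇒edgeCount≤ : ∀ {n} → 3 ≤ n → (G : Graph n) → Planar G → edgeCount G ≤ 3 * n ∸ 6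
planar⇒edgeCount≤ {n} 3≤n G (H , G⊆H , connected , rot , rotation , edgeless⊎euler) =
  ≤-trans (edgeCount-mono {G = G} {H} G⊆H) (H-bound edgeless⊎euler)
  where
  open Faces H rot rotation
  H-bound : edgeCount H ≡ 0 ⊎ n + faceCount H rot ≡ edgeCount H + 2 → edgeCount H ≤ 3 * n ∸ 6
  H-bound (inj₁ edgeless) = subst (_≤ 3 * n ∸ 6) (sym edgeless) z≤n
  H-bound (inj₂ euler)    = euler-bound n (edgeCount H) (faceCount H rot) euler
                              (faceCount-bound (connected⇒no-digon connected 3≤n))

-- Every edge of the path either has one of the K colours below K or meets one of
-- the s vertices below s; the former are at most K edges and each such vertex
-- lies on at most two edges.
rainbow-path-bound : ∀ {n m} (G : Graph n) (c : Fin n → Fin n → ℕ) (K s : ℕ) →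
  (∀ u v → Adj G u v → c u v < K ⊎ toℕ u < s ⊎ toℕ v < s) →
  (f : Fin (suc m) → Fin n) → IsRainbowPath G c f → m ≤ K + s + s
rainbow-path-bound {m = m} G c K s cover f ((f-injective , f-adjacent) , rainbow) = begin
  m                                                           ≡⟨ sym (sumFin-one m) ⟩
  sumFin {m} (λ _ → 1)
    ≤⟨ sumFin-mono (λ e → covered (cover _ _ (f-adjacent e))) ⟩
  sumFin (λ e → low-colour e + low-tail e + low-head e)
    ≡⟨ trans (sumFin-distrib-+ (λ e → low-colour e + low-tail e) low-head)
             (cong (_+ sumFin low-head) (sumFin-distrib-+ low-colour low-tail)) ⟩
  sumFin low-colour + sumFin low-tail + sumFin low-head
    ≤⟨ +-mono-≤ (+-mono-≤ (count-<-injective colour colour-injective K)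
                          (≤-trans (sumFin-init≤ low-vertex) low-vertices))
                (≤-trans (sumFin-tail≤ low-vertex) low-vertices) ⟩
  K + s + s                                                   ∎
  where
  open ≤-Reasoning
  colour : Fin m → ℕ
  colour e = c (f (inject₁ e)) (f (fsuc e))
  low-colour low-tail low-head : Fin m → ℕ
  low-colour e = ind (colour e <ᵇ K)
  low-tail e   = ind (toℕ (f (inject₁ e)) <ᵇ s)
  low-head e   = ind (toℕ (f (fsuc e)) <ᵇ s)
  low-vertex : Fin (suc m) → ℕ
  low-vertex i = ind (toℕ (f i) <ᵇ s)
  low-vertices : sumFin low-vertex ≤ s
  low-vertices = count-<-injective (λ i → toℕ (f i)) (λ eq → f-injective _ _ (toℕ-injective eq)) s
  colour-injective : ∀ {i j} → colour i ≡ colour j → i ≡ j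
  colour-injective {i} {j} eq with i Fin.≟ j
  ... | yes i≡j = i≡j
  ... | no  i≢j = ⊥-elim (rainbow i j i≢j eq)
  covered : ∀ {e} → colour e < K ⊎ toℕ (f (inject₁ e)) < s ⊎ toℕ (f (fsuc e)) < s →
            1 ≤ low-colour e + low-tail e + low-head e
  covered {e} (inj₁ lt)        rewrite <ᵇ-true lt = s≤s z≤n
  covered {e} (inj₂ (inj₁ lt)) rewrite <ᵇ-true lt = ≤-trans (m≤n+m 1 (low-colour e)) (m≤m+n _ _)
  covered {e} (inj₂ (inj₂ lt)) rewrite <ᵇ-true lt = m≤n+m 1 _

-- The extremal triangulation

≡ᵇ-2+ : ∀ j → (j ≡ᵇ suc (suc j)) ≡ false
≡ᵇ-2+ j = ≡ᵇ-false (<⇒≢ (≤-trans (n<1+n j) (n≤1+n (suc j))))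

pattern A   = 0
pattern B   = 1
pattern p i = suc (suc i)

-- The triangulation K₂ + P_{L+1}: apices A and B, joined to each other and to every
-- vertex of the path p 0 — p 1 — ⋯ — p L.
module Construction (L : ℕ) where

  N : ℕ
  N = 3 + L

  pathAdj : ℕ → ℕ → Bool
  pathAdj i j = (j ≡ᵇ suc i) ∨ (i ≡ᵇ suc j)

  adjℕ : ℕ → ℕ → Bool
  adjℕ A     A       = false
  adjℕ A     (suc _) = true
  adjℕ B     A       = true
  adjℕ B     B       = false
  adjℕ B     (p _)   = true
  adjℕ (p _) A       = true
  adjℕ (p _) B       = true
  adjℕ (p i) (p j)   = pathAdj i j

  -- around A:    B → p 0 → p 1 → ⋯ → p L → B
  -- around B:    A → p L → ⋯ → p 1 → p 0 → A
  -- around p i:  A → p (i - 1) → B → p (i + 1) → A   (skipping missing path neighbours)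
  rotℕ : ℕ → ℕ → ℕ
  rotℕ A           A           = A
  rotℕ A           B           = p 0
  rotℕ A           (p j)       = if j <ᵇ L then p (suc j) else B
  rotℕ B           A           = p L
  rotℕ B           B           = B
  rotℕ B           (p 0)       = A
  rotℕ B           (p (suc j)) = p j
  rotℕ (p i)       B           = if i ≡ᵇ L then A else p (suc i)
  rotℕ (p i)       (p j)       = if j ≡ᵇ suc i then A else if i ≡ᵇ suc j then B else p j
  rotℕ (p 0)       A           = B
  rotℕ (p (suc i)) A           = p i

  data Shape : ℕ → ℕ → Set where
    AB : Shape A B
    BA : Shape B A
    Ap : ∀ j → j ≤ L → Shape A (p j)
    pA : ∀ j → j ≤ L → Shape (p j) A
    Bp : ∀ j → j ≤ L → Shape B (p j)
    pB : ∀ j → j ≤ L → Shape (p j) B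
    p⁺ : ∀ i → suc i ≤ L → Shape (p i) (p (suc i))
    p⁻ : ∀ j → suc j ≤ L → Shape (p (suc j)) (p j)

  shape : ∀ x y → x < N → y < N → adjℕ x y ≡ true → Shape x y
  shape A     B     _ _ _ = AB
  shape B     A     _ _ _ = BA
  shape A     (p j) _ (s≤s (s≤s (s≤s j≤L))) _ = Ap j j≤L
  shape B     (p j) _ (s≤s (s≤s (s≤s j≤L))) _ = Bp j j≤L
  shape (p i) A     (s≤s (s≤s (s≤s i≤L))) _ _ = pA i i≤L
  shape (p i) B     (s≤s (s≤s (s≤s i≤L))) _ _ = pB i i≤L
  shape (p i) (p j) (s≤s (s≤s (s≤s i≤L))) (s≤s (s≤s (s≤s j≤L))) ij with j ≡ᵇ suc i in j≡1+i
  ... | true rewrite ≡ᵇ-true⇒≡ j (suc i) j≡1+i = p⁺ i j≤L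
  ... | false with i ≡ᵇ suc j in i≡1+j
  ... | true rewrite ≡ᵇ-true⇒≡ i (suc j) i≡1+j = p⁻ j i≤L
  shape (p i) (p j) _ _ () | false | false
  shape A A _ _ ()
  shape B B _ _ ()

  adjℕ-sym : ∀ x y → adjℕ x y ≡ adjℕ y x
  adjℕ-sym A     A     = refl
  adjℕ-sym A     B     = refl
  adjℕ-sym A     (p _) = refl
  adjℕ-sym B     A     = refl
  adjℕ-sym B     B     = refl
  adjℕ-sym B     (p _) = refl
  adjℕ-sym (p i) A     = refl
  adjℕ-sym (p i) B     = refl
  adjℕ-sym (p i) (p j) = ∨-comm (j ≡ᵇ suc i) (i ≡ᵇ suc j)

  adjℕ-irrefl : ∀ x → adjℕ x x ≡ false
  adjℕ-irrefl A     = refl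
  adjℕ-irrefl B     = refl
  adjℕ-irrefl (p i) rewrite ≡ᵇ-false (<⇒≢ (n<1+n i)) = refl

  rotℕ-bound : ∀ x y → x < N → y < N → rotℕ x y < N
  rotℕ-bound A     A           _ _ = s≤s z≤n
  rotℕ-bound A     B           _ _ = s≤s (s≤s (s≤s z≤n))
  rotℕ-bound A     (p j)       _ (s≤s (s≤s (s≤s j≤L))) with m≤n⇒m<n∨m≡n j≤L
  ... | inj₁ j<L  rewrite <ᵇ-true j<L = s≤s (s≤s (s≤s j<L))
  ... | inj₂ refl rewrite <ᵇ-false (≤-refl {j}) = s≤s (s≤s z≤n)
  rotℕ-bound B     A           _ _ = ≤-refl
  rotℕ-bound B     B           _ _ = s≤s (s≤s z≤n)
  rotℕ-bound B     (p 0)       _ _ = s≤s z≤n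
  rotℕ-bound B     (p (suc j)) _ (s≤s (s≤s (s≤s j<L))) = s≤s (s≤s (s≤s (<⇒≤ j<L)))
  rotℕ-bound (p 0)       A _ _ = s≤s (s≤s z≤n)
  rotℕ-bound (p (suc i)) A (s≤s (s≤s (s≤s i<L))) _ = s≤s (s≤s (s≤s (<⇒≤ i<L)))
  rotℕ-bound (p i)       B (s≤s (s≤s (s≤s i≤L))) _ with m≤n⇒m<n∨m≡n i≤L
  ... | inj₁ i<L  rewrite ≡ᵇ-false (<⇒≢ i<L) = s≤s (s≤s (s≤s i<L))
  ... | inj₂ refl rewrite ≡ᵇ-refl i = s≤s z≤n
  rotℕ-bound (p i) (p j) _ pj<N with j ≡ᵇ suc i
  ... | true  = s≤s z≤n
  ... | false with i ≡ᵇ suc j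
  ... | true  = s≤s (s≤s z≤n)
  ... | false = pj<N

  rotℕ-adj : ∀ {x y} → Shape x y → adjℕ x (rotℕ x y) ≡ true
  rotℕ-adj AB = refl
  rotℕ-adj (Ap j j≤L) with m≤n⇒m<n∨m≡n j≤L
  ... | inj₁ j<L  rewrite <ᵇ-true j<L = refl
  ... | inj₂ refl rewrite <ᵇ-false (≤-refl {j}) = refl
  rotℕ-adj BA = refl
  rotℕ-adj (Bp 0 _) = refl
  rotℕ-adj (Bp (suc j) _) = refl
  rotℕ-adj (pA 0 _) = refl
  rotℕ-adj (pA (suc j) _) rewrite ≡ᵇ-refl j = ∨-zeroʳ _
  rotℕ-adj (pB j j≤L) with m≤n⇒m<n∨m≡n j≤L
  ... | inj₁ j<L  rewrite ≡ᵇ-false (<⇒≢ j<L) | ≡ᵇ-refl j = refl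
  ... | inj₂ refl rewrite ≡ᵇ-refl j = refl
  rotℕ-adj (p⁺ i _) rewrite ≡ᵇ-refl i = refl
  rotℕ-adj (p⁻ j _) rewrite ≡ᵇ-2+ j | ≡ᵇ-refl j = refl

  faceStepℕ : ℕ × ℕ → ℕ × ℕ
  faceStepℕ (x , y) = y , rotℕ y x

  faceStepℕ³ : ∀ {x y} → Shape x y → faceStepℕ (faceStepℕ (faceStepℕ (x , y))) ≡ (x , y)
  faceStepℕ³ AB rewrite ≡ᵇ-refl L | <ᵇ-false (≤-refl {L}) = refl
  faceStepℕ³ (Ap 0 _) = refl
  faceStepℕ³ (Ap (suc j) j<L) rewrite ≡ᵇ-refl j | <ᵇ-true j<L = refl
  faceStepℕ³ BA = refl
  faceStepℕ³ (Bp j j≤L) with m≤n⇒m<n∨m≡n j≤L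
  ... | inj₁ j<L  rewrite ≡ᵇ-false (<⇒≢ j<L) | ≡ᵇ-2+ j | ≡ᵇ-refl j = refl
  ... | inj₂ refl rewrite ≡ᵇ-refl j | <ᵇ-false (≤-refl {j}) = refl
  faceStepℕ³ (pA j j≤L) with m≤n⇒m<n∨m≡n j≤L
  ... | inj₁ j<L  rewrite <ᵇ-true j<L | ≡ᵇ-refl j = refl
  ... | inj₂ refl rewrite <ᵇ-false (≤-refl {j}) | ≡ᵇ-refl j = refl
  faceStepℕ³ (pB 0 _) = refl
  faceStepℕ³ (pB (suc j) j<L) rewrite ≡ᵇ-false (<⇒≢ j<L) | ≡ᵇ-2+ j | ≡ᵇ-refl j = refl
  faceStepℕ³ (p⁺ i i<L) rewrite ≡ᵇ-2+ i | ≡ᵇ-refl i | ≡ᵇ-false (<⇒≢ i<L) = refl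
  faceStepℕ³ (p⁻ j j<L) rewrite ≡ᵇ-refl j | <ᵇ-true j<L = refl

  around-A-to-B : ∀ k j → j + k ≡ L → iter (rotℕ A) (suc k) (p j) ≡ B
  around-A-to-B zero    j j+0≡L
    rewrite <ᵇ-false {j} {L} (≤-reflexive (trans (sym j+0≡L) (+-identityʳ j))) = refl
  around-A-to-B (suc k) j j+1+k≡L = begin
    iter (rotℕ A) (suc (suc k)) (p j)      ≡⟨ iter-suc (rotℕ A) (suc k) (p j) ⟩
    iter (rotℕ A) (suc k) (rotℕ A (p j))   ≡⟨ cong (iter (rotℕ A) (suc k)) next ⟩
    iter (rotℕ A) (suc k) (p (suc j))      ≡⟨ around-A-to-B k (suc j) (trans (sym (+-suc j k)) j+1+k≡L) ⟩
    B                                      ∎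
    where
    open ≡-Reasoning
    next : rotℕ A (p j) ≡ p (suc j)
    next rewrite <ᵇ-true (subst (j <_) j+1+k≡L (m<m+n j z<s)) = refl

  around-A-from-B : ∀ j → j ≤ L → iter (rotℕ A) (suc j) B ≡ p j
  around-A-from-B zero    _     = refl
  around-A-from-B (suc j) j<L rewrite around-A-from-B j (<⇒≤ j<L) | <ᵇ-true j<L = refl

  around-B-to-A : ∀ j → iter (rotℕ B) (suc j) (p j) ≡ A
  around-B-to-A zero    = refl
  around-B-to-A (suc j) = trans (iter-suc (rotℕ B) (suc j) (p (suc j))) (around-B-to-A j)

  around-B-from-A : ∀ k j → j + k ≡ L → iter (rotℕ B) (suc k) A ≡ p j
  around-B-from-A zero    j j+0≡L = cong p (trans (sym j+0≡L) (+-identityʳ j))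
  around-B-from-A (suc k) j j+1+k≡L
    rewrite around-B-from-A k (suc j) (trans (sym (+-suc j k)) j+1+k≡L) = refl

  hub : ℕ → ℕ
  hub A       = B
  hub (suc _) = A

  to-hub : ∀ {x y} → Shape x y → ∃[ t ] iter (rotℕ x) t y ≡ hub x
  to-hub AB         = 0 , refl
  to-hub (Ap j j≤L) = suc (L ∸ j) , around-A-to-B (L ∸ j) j (m+[n∸m]≡n j≤L)
  to-hub BA         = 0 , refl
  to-hub (Bp j _)   = suc j , around-B-to-A j
  to-hub (pA j _)   = 0 , refl
  to-hub (pB j j≤L) with m≤n⇒m<n∨m≡n j≤L
  ... | inj₁ j<L  = 2 , via-p⁺
    where
    via-p⁺ : rotℕ (p j) (rotℕ (p j) B) ≡ A
    via-p⁺ rewrite ≡ᵇ-false (<⇒≢ j<L) | ≡ᵇ-refl j = refl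
  ... | inj₂ refl = 1 , direct
    where
    direct : rotℕ (p j) B ≡ A
    direct rewrite ≡ᵇ-refl j = refl
  to-hub (p⁺ i _) = 1 , direct
    where
    direct : rotℕ (p i) (p (suc i)) ≡ A
    direct rewrite ≡ᵇ-refl i = refl
  to-hub (p⁻ j j<L) with m≤n⇒m<n∨m≡n j<L
  ... | inj₁ 1+j<L = 3 , via-B-p⁺
    where
    via-B-p⁺ : rotℕ (p (suc j)) (rotℕ (p (suc j)) (rotℕ (p (suc j)) (p j))) ≡ A
    via-B-p⁺ rewrite ≡ᵇ-2+ j | ≡ᵇ-refl j | ≡ᵇ-false (<⇒≢ 1+j<L) | ≡ᵇ-refl j = refl
  ... | inj₂ refl = 2 , via-B
    where
    via-B : rotℕ (p (suc j)) (rotℕ (p (suc j)) (p j)) ≡ A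
    via-B rewrite ≡ᵇ-2+ j | ≡ᵇ-refl j | ≡ᵇ-refl j = refl

  from-hub : ∀ {x y} → Shape x y → ∃[ t ] iter (rotℕ x) t (hub x) ≡ y
  from-hub AB         = 0 , refl
  from-hub (Ap j j≤L) = suc j , around-A-from-B j j≤L
  from-hub BA         = 0 , refl
  from-hub (Bp j j≤L) = suc (L ∸ j) , around-B-from-A (L ∸ j) j (m+[n∸m]≡n j≤L)
  from-hub (pA j _)   = 0 , refl
  from-hub (pB 0 _)   = 1 , refl
  from-hub (pB (suc j) _) = 2 , via-p⁻
    where
    via-p⁻ : rotℕ (p (suc j)) (rotℕ (p (suc j)) A) ≡ B
    via-p⁻ rewrite ≡ᵇ-2+ j | ≡ᵇ-refl j = refl
  from-hub (p⁺ 0 0<L) = 2 , via-B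
    where
    via-B : rotℕ (p 0) (rotℕ (p 0) A) ≡ p 1
    via-B rewrite ≡ᵇ-false {0} {L} (<⇒≢ 0<L) = refl
  from-hub (p⁺ (suc j) 2+j≤L) = 3 , via-p⁻-B
    where
    via-p⁻-B : rotℕ (p (suc j)) (rotℕ (p (suc j)) (rotℕ (p (suc j)) A)) ≡ p (suc (suc j))
    via-p⁻-B rewrite ≡ᵇ-2+ j | ≡ᵇ-refl j | ≡ᵇ-false (<⇒≢ 2+j≤L) = refl
  from-hub (p⁻ j _) = 1 , refl

  rotℕ-cyclic : ∀ {x y z} → Shape x y → Shape x z → ∃[ t ] iter (rotℕ x) t y ≡ z
  rotℕ-cyclic {x} {y} {z} xy xz with to-hub xy | from-hub xz
  ... | t , y↦hub | s , hub↦z =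
    s + t , trans (iter-+ (rotℕ x) s t y) (trans (cong (iter (rotℕ x) s) y↦hub) hub↦z)

  successor-count : Σ< (suc L) (λ i → Σ< (suc L) (λ j → ind (j ≡ᵇ suc i))) ≡ L
  successor-count = begin
    Σ< (suc L) (λ i → Σ< (suc L) (λ j → ind (j ≡ᵇ suc i)))
      ≡⟨ sumFin-cong {suc L} (λ i → Σ<-≡ᵇ (suc L) (suc (toℕ i))) ⟩
    Σ< (suc L) (λ i → ind (i <ᵇ L))    ≡⟨ Σ<-<ᵇ (suc L) L ⟩
    suc L ⊓ L                          ≡⟨ m≥n⇒m⊓n≡n (n≤1+n L) ⟩
    L                                  ∎
    where open ≡-Reasoning

  path-degree : ℕ → ℕ
  path-degree i = Σ< (suc L) (λ j → ind (pathAdj i j))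

  path-degree-sum : Σ< (suc L) path-degree ≡ L + L
  path-degree-sum = begin
    Σ² (λ d → ind (pathAdj (i d) (j d)))                         ≡⟨ Σ²-cong (λ d → split (i d) (j d)) ⟩
    Σ² (λ d → next (i d) (j d) + next (j d) (i d))               ≡⟨ Σ²-distrib-+ (λ d → next (i d) (j d))
                                                                                  (λ d → next (j d) (i d)) ⟩
    Σ² (λ d → next (i d) (j d)) + Σ² (λ d → next (j d) (i d))    ≡⟨ cong₂ _+_ successor-count swapped ⟩
    L + L                                                         ∎
    where
    open ≡-Reasoning
    i j : Fin (suc L) × Fin (suc L) → ℕ
    i d = toℕ (proj₁ d)
    j d = toℕ (proj₂ d)
    next : ℕ → ℕ → ℕ
    next i j = ind (j ≡ᵇ suc i)
    split : ∀ i j → ind (pathAdj i j) ≡ next i j + next j i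
    split i j with j ≡ᵇ suc i in j≡1+i
    ... | false = refl
    ... | true rewrite ≡ᵇ-true⇒≡ j (suc i) j≡1+i | ≡ᵇ-2+ i = refl
    swapped : Σ² (λ d → next (j d) (i d)) ≡ L
    swapped = trans (sumFin-comm {suc L} {suc L} (λ u v → next (toℕ v) (toℕ u))) successor-count

  degree-sum : Σ< N (λ x → Σ< N (λ y → ind (adjℕ x y))) ≡ 6 * L + 6
  degree-sum = begin
    Σ< N (λ x → Σ< N (λ y → ind (adjℕ x y)))
      ≡⟨⟩
    Σ< (2 + L) (λ _ → 1) + (suc (Σ< (1 + L) (λ _ → 1)) + Σ< (suc L) (λ i → 2 + path-degree i))
      ≡⟨ cong₂ (λ a b → a + (suc b + Σ< (suc L) (λ i → 2 + path-degree i)))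
               (sumFin-one (2 + L)) (sumFin-one (1 + L)) ⟩
    2 + L + (2 + L + Σ< (suc L) (λ i → 2 + path-degree i))
      ≡⟨ cong (λ z → 2 + L + (2 + L + z)) (sumFin-distrib-+ {suc L} (λ _ → 2) (λ i → path-degree (toℕ i))) ⟩
    2 + L + (2 + L + (Σ< (suc L) (λ _ → 2) + Σ< (suc L) path-degree))
      ≡⟨ cong (λ z → 2 + L + (2 + L + z)) (cong₂ _+_ twos path-degree-sum) ⟩
    2 + L + (2 + L + ((suc L + suc L) + (L + L)))
      ≡⟨ solve 1 (λ l → con 2 :+ l :+ (con 2 :+ l :+ ((con 1 :+ l :+ (con 1 :+ l)) :+ (l :+ l)))
                        := con 6 :* l :+ con 6) refl L ⟩
    6 * L + 6 ∎
    where
    open ≡-Reasoning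
    open +-*-Solver
    twos : Σ< (suc L) (λ _ → 2) ≡ suc L + suc L
    twos = trans (sumFin-distrib-+ {suc L} (λ _ → 1) (λ _ → 1))
                 (cong₂ _+_ (sumFin-one (suc L)) (sumFin-one (suc L)))

  K₂+P : Graph N
  K₂+P = record
    { adj    = λ u v → adjℕ (toℕ u) (toℕ v)
    ; sym    = λ u v → adjℕ-sym (toℕ u) (toℕ v)
    ; irrefl = λ u → adjℕ-irrefl (toℕ u)
    }

  edge-shape : ∀ u v → Adj K₂+P u v → Shape (toℕ u) (toℕ v)
  edge-shape u v = shape (toℕ u) (toℕ v) (toℕ<n u) (toℕ<n v)

  rot : Fin N → Fin N → Fin N
  rot u v = Fin.fromℕ< (rotℕ-bound (toℕ u) (toℕ v) (toℕ<n u) (toℕ<n v))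

  toℕ-rot : ∀ u v → toℕ (rot u v) ≡ rotℕ (toℕ u) (toℕ v)
  toℕ-rot u v = FinP.toℕ-fromℕ< _

  toℕ-iter-rot : ∀ u t v → toℕ (iter (rot u) t v) ≡ iter (rotℕ (toℕ u)) t (toℕ v)
  toℕ-iter-rot u zero    v = refl
  toℕ-iter-rot u (suc t) v = trans (toℕ-rot u _) (cong (rotℕ (toℕ u)) (toℕ-iter-rot u t v))

  rotation : IsRotationSystem K₂+P rot
  rotation = (λ u v uv → trans (cong (adjℕ (toℕ u)) (toℕ-rot u v)) (rotℕ-adj (edge-shape u v uv)))
           , (λ u v w uv uw → let t , v↦w = rotℕ-cyclic (edge-shape u v uv) (edge-shape u w uw)
                              in t , toℕ-injective (trans (toℕ-iter-rot u t v) v↦w))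

  connected : Connected K₂+P
  connected u v = to-A u ⇝ from-A v
    where
    _⇝_ : ∀ {u v w} → Reach K₂+P u v → Reach K₂+P v w → Reach K₂+P u w
    here        ⇝ v⇝w = v⇝w
    step uv u⇝v ⇝ v⇝w = step uv (u⇝v ⇝ v⇝w)
    to-A : ∀ u → Reach K₂+P u fzero
    to-A fzero           = here
    to-A (fsuc fzero)    = step refl here
    to-A (fsuc (fsuc u)) = step refl here
    from-A : ∀ v → Reach K₂+P fzero v
    from-A fzero    = here
    from-A (fsuc v) = step refl here

  open Faces K₂+P rot rotation using (φ; D; faceCount-triangulation)

  faces-are-triangles : ∀ d → D d ≡ true → φ (φ (φ d)) ≡ d
  faces-are-triangles d dd = toℕ²-injective (begin
    toℕ² (φ (φ (φ d)))                          ≡⟨ toℕ²-φ (φ (φ d)) ⟩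
    faceStepℕ (toℕ² (φ (φ d)))                  ≡⟨ cong faceStepℕ (toℕ²-φ (φ d)) ⟩
    faceStepℕ (faceStepℕ (toℕ² (φ d)))          ≡⟨ cong (λ z → faceStepℕ (faceStepℕ z)) (toℕ²-φ d) ⟩
    faceStepℕ (faceStepℕ (faceStepℕ (toℕ² d)))  ≡⟨ faceStepℕ³ (edge-shape (proj₁ d) (proj₂ d) dd) ⟩
    toℕ² d                                      ∎)
    where
    open ≡-Reasoning
    toℕ² : Fin N × Fin N → ℕ × ℕ
    toℕ² (u , v) = toℕ u , toℕ v
    toℕ²-φ : ∀ d → toℕ² (φ d) ≡ faceStepℕ (toℕ² d)
    toℕ²-φ (u , v) = cong (toℕ v ,_) (toℕ-rot v u)
    toℕ²-injective : ∀ {d d′} → toℕ² d ≡ toℕ² d′ → d ≡ d′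
    toℕ²-injective {u , v} {u′ , v′} eq =
      cong₂ _,_ (toℕ-injective (cong proj₁ eq)) (toℕ-injective (cong proj₂ eq))

  edgeCount-K₂+P : edgeCount K₂+P ≡ 3 * L + 3
  edgeCount-K₂+P = *-cancelˡ-≡ _ _ 2 (begin
    2 * edgeCount K₂+P                  ≡⟨ cong (edgeCount K₂+P +_) (+-identityʳ _) ⟩
    edgeCount K₂+P + edgeCount K₂+P     ≡⟨ handshake K₂+P ⟩
    Σ² (λ d → ind (D d))                ≡⟨ degree-sum ⟩
    6 * L + 6                           ≡⟨ solve 1 (λ l → con 6 :* l :+ con 6 := con 2 :* (con 3 :* l :+ con 3)) refl L ⟩
    2 * (3 * L + 3)                     ∎)
    where
    open ≡-Reasoning
    open +-*-Solver

  faceCount-K₂+P : faceCount K₂+P rot ≡ 2 * L + 2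
  faceCount-K₂+P = *-cancelˡ-≡ _ _ 3 (begin
    3 * F                                ≡⟨ solve 1 (λ f → con 3 :* f := f :+ f :+ f) refl F ⟩
    F + F + F                            ≡⟨ faceCount-triangulation faces-are-triangles ⟩
    edgeCount K₂+P + edgeCount K₂+P      ≡⟨ cong₂ _+_ edgeCount-K₂+P edgeCount-K₂+P ⟩
    (3 * L + 3) + (3 * L + 3)
      ≡⟨ solve 1 (λ l → (con 3 :* l :+ con 3) :+ (con 3 :* l :+ con 3) := con 3 :* (con 2 :* l :+ con 2)) refl L ⟩
    3 * (2 * L + 2)                      ∎)
    where
    open ≡-Reasoning
    open +-*-Solver
    F = faceCount K₂+P rot

  planar : Planar K₂+P
  planar = K₂+P , (λ _ _ uv → uv) , connected , rot , rotation , inj₂ (begin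
    N + faceCount K₂+P rot     ≡⟨ cong (N +_) faceCount-K₂+P ⟩
    3 + L + (2 * L + 2)        ≡⟨ solve 1 (λ l → con 3 :+ l :+ (con 2 :* l :+ con 2) := con 3 :* l :+ con 3 :+ con 2) refl L ⟩
    3 * L + 3 + 2              ≡⟨ cong (_+ 2) (sym edgeCount-K₂+P) ⟩
    edgeCount K₂+P + 2         ∎)
    where
    open ≡-Reasoning
    open +-*-Solver

  parity : ℕ → ℕ
  parity 0             = 0
  parity 1             = 1
  parity (suc (suc k)) = parity k

  parity<2 : ∀ k → parity k < 2
  parity<2 0             = s≤s z≤n
  parity<2 1             = ≤-refl
  parity<2 (suc (suc k)) = parity<2 k

  parity-suc : ∀ k → parity (suc k) ≢ parity k
  parity-suc 0             ()
  parity-suc 1             ()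
  parity-suc (suc (suc k)) = parity-suc k

  -- the path edges alternate between the colours 0 and 1; every other edge meets an apex
  colourℕ : ℕ → ℕ → ℕ
  colourℕ A     y     = y + 2
  colourℕ B     y     = y + 3
  colourℕ (p i) A     = p i + 2
  colourℕ (p i) B     = p i + 3
  colourℕ (p i) (p j) = parity (i ⊓ j)

  colourℕ-sym : ∀ x y → colourℕ x y ≡ colourℕ y x
  colourℕ-sym A     A     = refl
  colourℕ-sym A     B     = refl
  colourℕ-sym A     (p j) = refl
  colourℕ-sym B     A     = refl
  colourℕ-sym B     B     = refl
  colourℕ-sym B     (p j) = refl
  colourℕ-sym (p i) A     = refl
  colourℕ-sym (p i) B     = refl
  colourℕ-sym (p i) (p j) = cong parity (⊓-comm i j)

  parity≢p+ : ∀ k i c → parity k ≢ p i + c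
  parity≢p+ k i c eq = <⇒≱ (parity<2 k) (subst (2 ≤_) (sym eq) (s≤s (s≤s z≤n)))

  path-colours : ∀ j → parity (suc j ⊓ suc (suc j)) ≡ parity (suc j ⊓ j) → parity (suc j) ≡ parity j
  path-colours j eq = begin
    parity (suc j)                 ≡⟨ cong parity (sym (m≤n⇒m⊓n≡m (n≤1+n (suc j)))) ⟩
    parity (suc j ⊓ suc (suc j))   ≡⟨ eq ⟩
    parity (suc j ⊓ j)             ≡⟨ cong parity (m≥n⇒m⊓n≡n (n≤1+n j)) ⟩
    parity j                       ∎
    where open ≡-Reasoning

  colourℕ-proper : ∀ {x y z} → Shape x y → Shape x z → y ≢ z → colourℕ x y ≢ colourℕ x z
  colourℕ-proper {A} _ _ y≢z eq = y≢z (+-cancelʳ-≡ 2 _ _ eq)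
  colourℕ-proper {B} _ _ y≢z eq = y≢z (+-cancelʳ-≡ 3 _ _ eq)
  colourℕ-proper (pA _ _) (pA _ _) y≢z _  = y≢z refl
  colourℕ-proper (pB _ _) (pB _ _) y≢z _  = y≢z refl
  colourℕ-proper (pA i _) (pB _ _) _ eq   = 1+n≢n (sym (+-cancelˡ-≡ (p i) 2 3 eq))
  colourℕ-proper (pB i _) (pA _ _) _ eq   = 1+n≢n (+-cancelˡ-≡ (p i) 3 2 eq)
  colourℕ-proper (pA i _) (p⁺ _ _) _ eq   = parity≢p+ (i ⊓ suc i) i       2 (sym eq)
  colourℕ-proper (pA _ _) (p⁻ j _) _ eq   = parity≢p+ (suc j ⊓ j) (suc j) 2 (sym eq)
  colourℕ-proper (pB i _) (p⁺ _ _) _ eq   = parity≢p+ (i ⊓ suc i) i       3 (sym eq)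
  colourℕ-proper (pB _ _) (p⁻ j _) _ eq   = parity≢p+ (suc j ⊓ j) (suc j) 3 (sym eq)
  colourℕ-proper (p⁺ i _) (pA _ _) _ eq   = parity≢p+ (i ⊓ suc i) i       2 eq
  colourℕ-proper (p⁻ j _) (pA _ _) _ eq   = parity≢p+ (suc j ⊓ j) (suc j) 2 eq
  colourℕ-proper (p⁺ i _) (pB _ _) _ eq   = parity≢p+ (i ⊓ suc i) i       3 eq
  colourℕ-proper (p⁻ j _) (pB _ _) _ eq   = parity≢p+ (suc j ⊓ j) (suc j) 3 eq
  colourℕ-proper (p⁺ _ _) (p⁺ _ _) y≢z _  = y≢z refl
  colourℕ-proper (p⁻ _ _) (p⁻ _ _) y≢z _  = y≢z refl
  colourℕ-proper (p⁺ _ _) (p⁻ j _) _ eq   = parity-suc j (path-colours j eq)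
  colourℕ-proper (p⁻ j _) (p⁺ _ _) _ eq   = parity-suc j (path-colours j (sym eq))

  colourℕ-cover : ∀ x y → colourℕ x y < 2 ⊎ x < 2 ⊎ y < 2
  colourℕ-cover A     _     = inj₂ (inj₁ (s≤s z≤n))
  colourℕ-cover B     _     = inj₂ (inj₁ ≤-refl)
  colourℕ-cover (p i) A     = inj₂ (inj₂ (s≤s z≤n))
  colourℕ-cover (p i) B     = inj₂ (inj₂ ≤-refl)
  colourℕ-cover (p i) (p j) = inj₁ (parity<2 (i ⊓ j))

  colour : Fin N → Fin N → ℕ
  colour u v = colourℕ (toℕ u) (toℕ v)

  colour-proper : ProperColouring K₂+P colour
  colour-proper = (λ u v _ → colourℕ-sym (toℕ u) (toℕ v))
                , (λ u v w uv uw v≢w → colourℕ-proper (edge-shape u v uv) (edge-shape u w uw)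
                                                      (λ eq → v≢w (toℕ-injective eq)))

  rainbow-P₈-free : ∀ m → 7 ≤ m → RainbowPathFree (suc m) K₂+P colour
  rainbow-P₈-free m 7≤m (f , rainbow) =
    <⇒≱ 7≤m (rainbow-path-bound K₂+P colour 2 2 (λ u v _ → colourℕ-cover (toℕ u) (toℕ v)) f rainbow)

3[3+L]∸6 : ∀ L → 3 * (3 + L) ∸ 6 ≡ 3 * L + 3
3[3+L]∸6 L = trans (cong (_∸ 6) (solve 1 (λ l → con 3 :* (con 3 :+ l) := (con 3 :* l :+ con 3) :+ con 6) refl L))
                   (m+n∸n≡m (3 * L + 3) 6)
  where open +-*-Solver

theorem6 : ∀ (n k : ℕ) → 8 ≤ k → k ≤ n →
    RainbowPlanarTuranPath≡ n k (3 * n ∸ 6)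
theorem6 n k 8≤k k≤n with ≤-trans 8≤k k≤n | 8≤k
... | s≤s (s≤s (s≤s {n = L} _)) | s≤s 7≤m =
  ( K₂+P , planar , (colour , colour-proper , rainbow-P₈-free _ 7≤m)
  , trans edgeCount-K₂+P (sym (3[3+L]∸6 L)) )
  , λ G G-planar _ → planar⇒edgeCount≤ (s≤s (s≤s (s≤s z≤n))) G G-planar
  where open Construction L
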